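{- For all acyclic graphs $G$, $\operatorname{adim}(G)=O\big((\operatorname{bdim}(G))^2\big)$; that is, there is an absolute constant $C$ with $\operatorname{adim}(G)\le C(\operatorname{bdim}(G))^2$ for every acyclic graph $G$.
   Context: All graphs are finite, simple and undirected. $d(u,v)$ is graph distance ($\infty$ between different components) and $d_k(u,v)=\min\{d(u,v),k+1\}$. A function $f:V(G)\to\mathbb{Z}_{\ge0}$ is a resolving broadcast of $G$ if for any distinct $x,y$ there is $z$ with $f(z)>0$ and $d_{f(z)}(x,z)\ne d_{f(z)}(y,z)$; $\operatorname{bdim}(G)$ is the minimum of $\sum_v f(v)$ over resolving broadcasts. A set $A\subseteq V(G)$ is an adjacency resolving set if for any distinct $x,y$ there is $z\in A$ with $d_1(x,z)\ne d_1(y,z)$; $\operatorname{adim}(G)$ is the minimum size of such a set. -}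

module Defs where

open import Data.Nat using (ℕ; zero; suc; _≤_; _+_; _*_)
open import Data.Bool using (Bool; true; false; _∨_; _∧_; if_then_else_; T)
open import Data.Fin using (Fin; _≟_)
open import Data.Fin.Subset using (Subset; _∈_; ∣_∣)
open import Data.List using (List; []; _∷_; length; allFin)
open import Data.Bool.ListAction using (any)
open import Data.List.Relation.Unary.Unique.Propositional using (Unique)
open import Data.Vec using (tabulate; sum)
open import Data.Product using (Σ; ∃; _×_)
open import Relation.Nullary using (¬_)
open import Relation.Nullary.Decidable using (⌊_⌋)
open import Relation.Binary.PropositionalEquality using (_≡_; _≢_)

record Graph (n : ℕ) : Set where
  field
    adj   : Fin n → Fin n → Bool
    sym   : ∀ u v → adj u v ≡ adj v u
    irrefl : ∀ u → adj u u ≡ false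
open Graph public

reach : ∀ {n} → Graph n → ℕ → Fin n → Fin n → Bool
reach G zero    u v = ⌊ u ≟ v ⌋
reach G (suc m) u v = reach G m u v ∨ any (λ w → reach G m u w ∧ adj G w v) (allFin _)

distFrom : ∀ {n} → Graph n → (k : ℕ) → Fin n → Fin n → ℕ → ℕ → ℕ
distFrom G k u v i zero     = suc k
distFrom G k u v i (suc r)  = if reach G i u v then i else distFrom G k u v (suc i) r

-- Truncated distance d_k(u,v) = min { d(u,v), k+1 }  (d = ∞ across components).
dk : ∀ {n} → Graph n → ℕ → Fin n → Fin n → ℕ
dk G k u v = distFrom G k u v 0 (suc k)

IsResolvingBroadcast : ∀ {n} → Graph n → (Fin n → ℕ) → Set
IsResolvingBroadcast {n} G f =
  ∀ (x y : Fin n) → x ≢ y →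
    ∃ λ (z : Fin n) → ¬ (f z ≡ 0) × (dk G (f z) x z ≢ dk G (f z) y z)

cost : ∀ {n} → (Fin n → ℕ) → ℕ
cost f = sum (tabulate f)

IsAdjResolvingSet : ∀ {n} → Graph n → Subset n → Set
IsAdjResolvingSet {n} G A =
  ∀ (x y : Fin n) → x ≢ y →
    ∃ λ (z : Fin n) → z ∈ A × (dk G 1 x z ≢ dk G 1 y z)

Chain : ∀ {n} → Graph n → List (Fin n) → Set
Chain G []           = Data.Unit.⊤ where import Data.Unit
Chain G (u ∷ [])     = Data.Unit.⊤ where import Data.Unit
Chain G (u ∷ v ∷ vs) = T (adj G u v) × Chain G (v ∷ vs)

last : ∀ {n} → Fin n → List (Fin n) → Fin n
last u []       = u
last u (v ∷ vs) = last v vs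

IsCycle : ∀ {n} → Graph n → List (Fin n) → Set
IsCycle G []       = Data.Empty.⊥ where import Data.Empty
IsCycle G (u ∷ vs) =
  3 ≤ length (u ∷ vs) × Unique (u ∷ vs) × Chain G (u ∷ vs) × T (adj G (last u vs) u)

Acyclic : ∀ {n} → Graph n → Set
Acyclic {n} G = ∀ (c : List (Fin n)) → ¬ IsCycle G c

module Submission where

-- All vertices but one always form an adjacency resolving set, so it suffices
-- to show that an acyclic graph with a resolving broadcast f of cost s has at
-- most 1 + (2s)² vertices.  This follows from an injective code.  A vertex x
-- heard by some broadcaster z (f(z) ≥ 1 and d(x,z) ≤ f(z)) is encoded by z and
-- d(x,z) together with w and d(x,w), where w is the hearer of x whose common
-- ancestor with x, in the breadth-first tree rooted at z, is deepest; the at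
-- most one vertex heard by nobody gets its own code.  Each (broadcaster,
-- reading) pair ranges over at most 2s values.  The heart of the proof is the
-- injectivity (`no-collision`): if x ≠ y had equal codes, every broadcaster
-- separating them would share more ancestry with x or y than w does
-- (`separator-is-deep`), contradicting the choice of w.

open import Defs hiding (sym)
open import Data.Nat
  using (ℕ; zero; suc; pred; _≤_; _<_; _+_; _*_; _∸_; _⊓_; z≤n; s≤s; z<s; _≤?_; _<?_; >-nonZero)
  renaming (_≟_ to _≟ℕ_)
open import Data.Nat.Properties hiding (_≟_)
open import Data.Nat.Solver using (module +-*-Solver)
open import Data.Bool using (true; false; T)
open import Data.Bool.Properties using (T-∨; T-∧)
open import Data.Unit using (tt)
open import Data.Empty using (⊥; ⊥-elim)
open import Data.Product using (Σ; ∃; _×_; _,_; proj₁; proj₂; map₁)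
open import Data.Sum using (_⊎_; inj₁; inj₂; [_,_])
open import Data.Maybe using (Maybe; just; nothing)
open import Data.Maybe.Properties using (just-injective)
open import Data.Fin using (Fin; _≟_)
import Data.Fin as Fin
open import Data.Fin.Properties using (any?; injective⇒≤)
open import Data.Fin.Subset as Subset using (Subset; ∣_∣; outside)
open import Data.Fin.Subset.Properties using (∈⊤; ∣⊤∣≡n)
import Data.Vec as Vec
open import Data.List using (List; []; _∷_; allFin; applyUpTo; filter; length; map; _++_; lookup; upTo; cartesianProduct)
open import Data.List.Properties using (length-applyUpTo; length-++; length-map; length-upTo)
open import Data.List.Extrema ≤-totalOrder using (argmax; argmax-all; f[xs]≤f[argmax])
open import Data.List.Membership.Propositional using (_∈_; lose)
open import Data.List.Membership.Propositional.Properties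
  using (∈-allFin; ∈-filter⁺; ∈-cartesianProduct⁺; ∈-map⁺; ∈-++⁺ˡ; ∈-++⁺ʳ; ∈-upTo⁺)
open import Data.List.Relation.Unary.Any using (here; there; satisfied; index)
open import Data.List.Relation.Unary.Any.Properties using (any⁺; any⁻; lookup-index)
import Data.List.Relation.Unary.All as All
open import Data.List.Relation.Unary.All.Properties using (all-filter)
open import Data.List.Relation.Unary.Unique.Propositional.Properties using (applyUpTo⁺₁)
open import Function using (Equivalence; _∘_)
open import Relation.Nullary using (¬_; Dec; yes; no)
open import Relation.Nullary.Decidable using (toWitness; fromWitness; T?; _×-dec_)
open import Relation.Binary using (tri<; tri≈; tri>)
open import Relation.Binary.PropositionalEquality hiding ([_])

open Equivalence using (to; from)
open +-*-Solver using (solve; _:+_; _:*_; con; _:=_)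

Adj : ∀ {n} → Graph n → Fin n → Fin n → Set
Adj G u v = T (adj G u v)

-- `Within G m u v` holds iff there is a walk of length at most m from u to v,
-- i.e. iff d(u,v) ≤ m.  The record wrapper lets Agda infer G, m, u and v.
record Within {n} (G : Graph n) (m : ℕ) (u v : Fin n) : Set where
  constructor within
  field reached : T (reach G m u v)

IsDist : ∀ {n} → Graph n → ℕ → Fin n → Fin n → Set
IsDist G d u v = Within G d u v × (∀ j → j < d → ¬ Within G j u v)

module Walks {n : ℕ} (G : Graph n) where

  adj-sym : ∀ {u v} → Adj G u v → Adj G v u
  adj-sym {u} {v} a = subst T (Graph.sym G u v) a

  within-refl : ∀ u → Within G 0 u u
  within-refl u = within (fromWitness refl)

  within-zero : ∀ {u v} → Within G 0 u v → u ≡ v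
  within-zero (within r) = toWitness r

  within-suc : ∀ {m u v} → Within G m u v → Within G (suc m) u v
  within-suc (within r) = within (from T-∨ (inj₁ r))

  within-step : ∀ {m u w v} → Within G m u w → Adj G w v → Within G (suc m) u v
  within-step {w = w} (within r) a =
    within (from T-∨ (inj₂ (any⁺ _ (lose (∈-allFin w) (from T-∧ (r , a))))))

  within-inv : ∀ {m u v} → Within G (suc m) u v →
               Within G m u v ⊎ ∃ λ w → Within G m u w × Adj G w v
  within-inv (within r) with to T-∨ r
  ... | inj₁ short = inj₁ (within short)
  ... | inj₂ last with satisfied (any⁻ _ (allFin _) last)
  ...   | w , rw = let (r′ , a) = to T-∧ rw in inj₂ (w , within r′ , a)

  within-++ : ∀ {m m′ u w v} → Within G m u w → Within G m′ w v → Within G (m + m′) u v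
  within-++ {m} {zero} r r′ rewrite +-identityʳ m | within-zero r′ = r
  within-++ {m} {suc m′} r r′ rewrite +-suc m m′ with within-inv r′
  ... | inj₁ short = within-suc (within-++ r short)
  ... | inj₂ (w , r″ , a) = within-step (within-++ r r″) a

  within-edge : ∀ {u v} → Adj G u v → Within G 1 u v
  within-edge {u} a = within-step (within-refl u) a

  within-sym : ∀ {m u v} → Within G m u v → Within G m v u
  within-sym {zero} r rewrite within-zero r = within-refl _
  within-sym {suc m} r with within-inv r
  ... | inj₁ short = within-suc (within-sym short)
  ... | inj₂ (w , r′ , a) = within-++ (within-edge (adj-sym a)) (within-sym r′)

  isDist-sym : ∀ {d u v} → IsDist G d u v → IsDist G d v u
  isDist-sym (r , short) = within-sym r , λ j j<d r′ → short j j<d (within-sym r′)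

module TruncatedDistance {n : ℕ} (G : Graph n) (k : ℕ) (u v : Fin n) where

  Unreached : ℕ → Set
  Unreached i = ∀ j → j < i → ¬ Within G j u v

  unreached-suc : ∀ {i} → Unreached i → reach G i u v ≡ false → Unreached (suc i)
  unreached-suc none miss j j<1+i with m≤n⇒m<n∨m≡n (≤-pred j<1+i)
  ... | inj₁ j<i = none j j<i
  ... | inj₂ refl = λ w → subst T miss (Within.reached w)

  scan-spec : ∀ i r → Unreached i →
              (distFrom G k u v i r ≡ suc k × Unreached (i + r))
              ⊎ (distFrom G k u v i r < i + r × IsDist G (distFrom G k u v i r) u v)
  scan-spec i zero none = inj₁ (refl , subst Unreached (sym (+-identityʳ i)) none)
  scan-spec i (suc r) none with reach G i u v in hit
  ... | true = inj₂ (m<m+n i z<s , within (subst T (sym hit) tt) , none)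
  ... | false with scan-spec (suc i) r (unreached-suc none hit)
  ...   | inj₁ (e , none′) = inj₁ (e , subst Unreached (sym (+-suc i r)) none′)
  ...   | inj₂ (lt , dist) = inj₂ (subst (distFrom G k u v (suc i) r <_) (sym (+-suc i r)) lt , dist)

  dk-spec : (dk G k u v ≡ suc k × Unreached (suc k))
          ⊎ (dk G k u v ≤ k × IsDist G (dk G k u v) u v)
  dk-spec with scan-spec 0 (suc k) (λ _ ())
  ... | inj₁ far = inj₁ far
  ... | inj₂ (s≤s d≤k , dist) = inj₂ (d≤k , dist)

  dk-≤-suc : dk G k u v ≤ suc k
  dk-≤-suc with dk-spec
  ... | inj₁ (e , _) = ≤-reflexive e
  ... | inj₂ (d≤k , _) = m≤n⇒m≤1+n d≤k

  dk-within : dk G k u v ≤ k → Within G (dk G k u v) u v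
  dk-within d≤k with dk-spec
  ... | inj₁ (e , _) = ⊥-elim (1+n≰n (subst (_≤ k) e d≤k))
  ... | inj₂ (_ , r , _) = r

  dk-minimal : ∀ j → j < dk G k u v → ¬ Within G j u v
  dk-minimal j j<d with dk-spec
  ... | inj₁ (e , none) = none j (subst (j <_) e j<d)
  ... | inj₂ (_ , _ , short) = short j j<d

  dk-≤ : ∀ j → Within G j u v → j ≤ k → dk G k u v ≤ j
  dk-≤ j r _ with dk G k u v ≤? j
  ... | yes d≤j = d≤j
  ... | no d≰j = ⊥-elim (dk-minimal j (≰⇒> d≰j) r)

  dk-exact : ∀ d → IsDist G d u v → d ≤ k → dk G k u v ≡ d
  dk-exact d (r , short) d≤k with dk G k u v <? d
  ... | yes d′<d = ⊥-elim (short _ d′<d (dk-within (≤-trans (<⇒≤ d′<d) d≤k)))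
  ... | no d′≮d = ≤-antisym (dk-≤ d r d≤k) (≮⇒≥ d′≮d)

  dk-far : ¬ (dk G k u v ≤ k) → dk G k u v ≡ suc k
  dk-far d≰k with dk-spec
  ... | inj₁ (e , _) = e
  ... | inj₂ (d≤k , _) = ⊥-elim (d≰k d≤k)

record Path {n} (G : Graph n) (a b : Fin n) (m : ℕ) : Set where
  field
    vertex   : ℕ → Fin n
    start    : vertex 0 ≡ a
    end      : vertex m ≡ b
    step     : ∀ r → r < m → Adj G (vertex r) (vertex (suc r))
    distinct : ∀ {i j} → i < j → j ≤ m → vertex i ≢ vertex j

module Paths {n : ℕ} (G : Graph n) where
  open Path

  AllOn : ∀ {a b m} → Path G a b m → (Fin n → Set) → Set
  AllOn {m = m} π P = ∀ r → r ≤ m → P (vertex π r)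

  Avoids : ∀ {a b m} → Path G a b m → Fin n → Set
  Avoids π x = AllOn π (_≢ x)

  stay : ∀ a → Path G a a 0
  stay a = record { vertex = λ _ → a ; start = refl ; end = refl
                  ; step = λ _ () ; distinct = λ i<j j≤0 → ⊥-elim (n≮0 (<-≤-trans i<j j≤0)) }

  private
    prepend : Fin n → (ℕ → Fin n) → ℕ → Fin n
    prepend x V zero = x
    prepend x V (suc r) = V r

    append : (ℕ → Fin n) → ℕ → Fin n → ℕ → Fin n
    append V m y r with r ≤? m
    ... | yes _ = V r
    ... | no _ = y

    append-old : ∀ V m y r → r ≤ m → append V m y r ≡ V r
    append-old V m y r r≤m with r ≤? m
    ... | yes _ = refl
    ... | no r≰m = ⊥-elim (r≰m r≤m)

    append-new : ∀ V m y → append V m y (suc m) ≡ y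
    append-new V m y with suc m ≤? m
    ... | yes 1+m≤m = ⊥-elim (1+n≰n 1+m≤m)
    ... | no _ = refl

  cons : ∀ {a b m} x (π : Path G a b m) → Adj G x a → Avoids π x → Path G x b (suc m)
  cons {m = m} x π x~a fresh = record
    { vertex = prepend x (vertex π) ; start = refl ; end = end π ; step = step′ ; distinct = distinct′ }
    where
    step′ : ∀ r → r < suc m → Adj G (prepend x (vertex π) r) (prepend x (vertex π) (suc r))
    step′ zero _ = subst (Adj G x) (sym (start π)) x~a
    step′ (suc r) (s≤s r<m) = step π r r<m
    distinct′ : ∀ {i j} → i < j → j ≤ suc m → prepend x (vertex π) i ≢ prepend x (vertex π) j
    distinct′ {zero} {suc j} _ (s≤s j≤m) e = fresh j j≤m (sym e)
    distinct′ {suc i} {suc j} (s≤s i<j) (s≤s j≤m) = distinct π i<j j≤m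

  cons-all : ∀ {a b m P} x (π : Path G a b m) x~a fresh →
             P x → AllOn π P → AllOn (cons x π x~a fresh) P
  cons-all x π _ _ px all zero _ = px
  cons-all x π _ _ px all (suc r) (s≤s r≤m) = all r r≤m

  snoc : ∀ {a b m} (π : Path G a b m) y → Adj G b y → Avoids π y → Path G a y (suc m)
  snoc {m = m} π y b~y fresh = record
    { vertex = V′ ; start = trans (old 0 z≤n) (start π) ; end = append-new (vertex π) m y
    ; step = step′ ; distinct = distinct′ }
    where
    V′ = append (vertex π) m y
    old = append-old (vertex π) m y
    step′ : ∀ r → r < suc m → Adj G (V′ r) (V′ (suc r))
    step′ r (s≤s r≤m) with m≤n⇒m<n∨m≡n r≤m
    ... | inj₁ r<m = subst₂ (Adj G) (sym (old r r≤m)) (sym (old (suc r) r<m)) (step π r r<m)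
    ... | inj₂ refl = subst₂ (Adj G) (sym (trans (old r r≤m) (end π))) (sym (append-new (vertex π) m y)) b~y
    distinct′ : ∀ {i j} → i < j → j ≤ suc m → V′ i ≢ V′ j
    distinct′ {i} {j} i<j j≤1+m with m≤n⇒m<n∨m≡n j≤1+m
    ... | inj₁ (s≤s j≤m) = subst₂ _≢_ (sym (old i (<⇒≤ (<-≤-trans i<j j≤m)))) (sym (old j j≤m))
                             (distinct π i<j j≤m)
    ... | inj₂ refl = subst₂ _≢_ (sym (old i (≤-pred i<j))) (sym (append-new (vertex π) m y))
                             (fresh i (≤-pred i<j))

  snoc-all : ∀ {a b m P} (π : Path G a b m) y b~y fresh →
             AllOn π P → P y → AllOn (snoc π y b~y fresh) P
  snoc-all {m = m} {P} π y _ _ all py r r≤1+m with m≤n⇒m<n∨m≡n r≤1+m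
  ... | inj₁ (s≤s r≤m) = subst P (sym (append-old (vertex π) m y r r≤m)) (all r r≤m)
  ... | inj₂ refl = subst P (sym (append-new (vertex π) m y)) py

  private
    chain-applyUpTo : ∀ (V : ℕ → Fin n) m → (∀ r → r < m → Adj G (V r) (V (suc r))) →
                      Chain G (applyUpTo V (suc m))
    chain-applyUpTo V zero _ = tt
    chain-applyUpTo V (suc m) step′ =
      step′ 0 z<s , chain-applyUpTo (λ r → V (suc r)) m (λ r r<m → step′ (suc r) (s≤s r<m))

    last-applyUpTo : ∀ (V : ℕ → Fin n) m → last (V 0) (applyUpTo (λ r → V (suc r)) m) ≡ V m
    last-applyUpTo V zero = refl
    last-applyUpTo V (suc m) = last-applyUpTo (λ r → V (suc r)) m

  closed-path-is-cycle : ∀ {a b m} (π : Path G a b m) → 2 ≤ m → Adj G b a →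
                         IsCycle G (applyUpTo (vertex π) (suc m))
  closed-path-is-cycle {m = m} π 2≤m b~a =
      subst (3 ≤_) (sym (length-applyUpTo (vertex π) (suc m))) (s≤s 2≤m)
    , applyUpTo⁺₁ (vertex π) (suc m) (λ i<j j<1+m → distinct π i<j (≤-pred j<1+m))
    , chain-applyUpTo (vertex π) m (step π)
    , subst₂ (Adj G) (sym (trans (last-applyUpTo (vertex π) m) (end π))) (sym (start π)) b~a

module Greatest {P : ℕ → Set} (P? : ∀ j → Dec (P j)) where

  greatest : ℕ → ℕ
  greatest zero = zero
  greatest (suc m) with P? (suc m)
  ... | yes _ = suc m
  ... | no _ = greatest m

  greatest-≤ : ∀ m → greatest m ≤ m
  greatest-≤ zero = z≤n
  greatest-≤ (suc m) with P? (suc m)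
  ... | yes _ = ≤-refl
  ... | no _ = m≤n⇒m≤1+n (greatest-≤ m)

  greatest-holds : P 0 → ∀ m → P (greatest m)
  greatest-holds P0 zero = P0
  greatest-holds P0 (suc m) with P? (suc m)
  ... | yes p = p
  ... | no _ = greatest-holds P0 m

  greatest-max : ∀ m j → j ≤ m → P j → j ≤ greatest m
  greatest-max zero j j≤0 _ = j≤0
  greatest-max (suc m) j j≤1+m pj with P? (suc m)
  ... | yes _ = j≤1+m
  ... | no ¬p with m≤n⇒m<n∨m≡n j≤1+m
  ...   | inj₁ (s≤s j≤m) = greatest-max m j j≤m pj
  ...   | inj₂ refl = ⊥-elim (¬p pj)

-- None of
-- this needs acyclicity; every statement concerns vertices of depth ≤ K.
module BreadthFirst {n : ℕ} (G : Graph n) (z : Fin n) (K : ℕ) where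
  open Walks G

  depth : Fin n → ℕ
  depth u = dk G K z u

  private
    module Depth (u : Fin n) = TruncatedDistance G K z u

  depth-within : ∀ {u} → depth u ≤ K → Within G (depth u) z u
  depth-within {u} = Depth.dk-within u

  depth-≤ : ∀ {u} j → Within G j z u → j ≤ K → depth u ≤ j
  depth-≤ {u} = Depth.dk-≤ u

  depth-zero : ∀ {u} → depth u ≡ 0 → z ≡ u
  depth-zero {u} e = within-zero (subst (λ j → Within G j z u) e (depth-within (subst (_≤ K) (sym e) z≤n)))

  depth-edge : ∀ {u v} → Adj G u v → depth v ≤ suc (depth u)
  depth-edge {u} {v} u~v with suc (depth u) ≤? K
  ... | yes 1+d≤K = depth-≤ (suc (depth u)) (within-step (depth-within (<⇒≤ 1+d≤K)) u~v) 1+d≤K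
  ... | no 1+d≰K = ≤-trans (Depth.dk-≤-suc v) (s≤s (≤-pred (≰⇒> 1+d≰K)))

  depth-walk : ∀ {m u v} → depth u + m ≤ K → Within G m u v → depth v ≤ depth u + m
  depth-walk {m} {u} du+m≤K r =
    depth-≤ (depth u + m) (within-++ (depth-within (≤-trans (m≤m+n (depth u) m) du+m≤K)) r) du+m≤K

  IsParent : Fin n → Fin n → Set
  IsParent w u = Adj G w u × suc (depth w) ≡ depth u

  isParent? : ∀ w u → Dec (IsParent w u)
  isParent? w u = T? (adj G w u) ×-dec (suc (depth w) ≟ℕ depth u)

  parent-exists : ∀ {u j} → depth u ≡ suc j → depth u ≤ K → ∃ λ w → IsParent w u
  parent-exists {u} {j} d≡1+j d≤K with within-inv (subst (λ i → Within G i z u) d≡1+j (depth-within d≤K))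
  ... | inj₁ short = ⊥-elim (Depth.dk-minimal u j (subst (j <_) (sym d≡1+j) ≤-refl) short)
  ... | inj₂ (w , r , w~u) =
        w , w~u , ≤-antisym (subst (suc (depth w) ≤_) (sym d≡1+j) (s≤s (depth-≤ j r j≤K)))
                            (depth-edge w~u)
    where j≤K = <⇒≤ (subst (_≤ K) d≡1+j d≤K)

  -- A chosen parent; vertices without one (the root, far vertices) map to themselves.
  parent : Fin n → Fin n
  parent u with any? (λ w → isParent? w u)
  ... | yes (w , _) = w
  ... | no _ = u

  parent-spec : ∀ {u} → 0 < depth u → depth u ≤ K → IsParent (parent u) u
  parent-spec {u} 0<d d≤K with any? (λ w → isParent? w u)
  ... | yes (_ , p) = p
  ... | no none = ⊥-elim (none (parent-exists (sym (suc-pred (depth u) ⦃ >-nonZero 0<d ⦄)) d≤K))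

  up : ℕ → Fin n → Fin n
  up zero u = u
  up (suc i) u = parent (up i u)

  up-depth : ∀ {u} i → depth u ≤ K → i ≤ depth u → depth (up i u) ≡ depth u ∸ i
  up-depth zero _ _ = refl
  up-depth {u} (suc i) d≤K 1+i≤d = begin
    depth (parent (up i u))       ≡⟨ cong pred (proj₂ (parent-spec 0<dᵢ dᵢ≤K)) ⟩
    pred (depth (up i u))         ≡⟨ cong pred dᵢ ⟩
    pred (depth u ∸ i)            ≡⟨ pred[m∸n]≡m∸[1+n] (depth u) i ⟩
    depth u ∸ suc i               ∎
    where
    open ≡-Reasoning
    dᵢ : depth (up i u) ≡ depth u ∸ i
    dᵢ = up-depth i d≤K (<⇒≤ 1+i≤d)
    0<dᵢ : 0 < depth (up i u)
    0<dᵢ = subst (0 <_) (sym dᵢ) (m<n⇒0<n∸m 1+i≤d)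
    dᵢ≤K : depth (up i u) ≤ K
    dᵢ≤K = subst (_≤ K) (sym dᵢ) (≤-trans (m∸n≤m _ i) d≤K)

  up-parent : ∀ {u} i → depth u ≤ K → suc i ≤ depth u → IsParent (up (suc i) u) (up i u)
  up-parent {u} i d≤K 1+i≤d = parent-spec (subst (0 <_) (sym dᵢ) (m<n⇒0<n∸m 1+i≤d))
                                          (subst (_≤ K) (sym dᵢ) (≤-trans (m∸n≤m _ i) d≤K))
    where dᵢ = up-depth i d≤K (<⇒≤ 1+i≤d)

  up-within : ∀ {u} i → depth u ≤ K → i ≤ depth u → Within G i u (up i u)
  up-within {u} zero _ _ = within-refl u
  up-within (suc i) d≤K 1+i≤d =
    within-step (up-within i d≤K (<⇒≤ 1+i≤d)) (adj-sym (proj₁ (up-parent i d≤K 1+i≤d)))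

  up-+ : ∀ i j u → up i (up j u) ≡ up (i + j) u
  up-+ zero j u = refl
  up-+ (suc i) j u = cong parent (up-+ i j u)

  anc : ℕ → Fin n → Fin n
  anc j u = up (depth u ∸ j) u

  anc-depth : ∀ {u} j → depth u ≤ K → j ≤ depth u → depth (anc j u) ≡ j
  anc-depth {u} j d≤K j≤d = trans (up-depth (depth u ∸ j) d≤K (m∸n≤m _ j)) (m∸[m∸n]≡n j≤d)

  anc-root : ∀ {u} → depth u ≤ K → anc 0 u ≡ z
  anc-root d≤K = sym (depth-zero (anc-depth 0 d≤K z≤n))

  anc-up : ∀ {u} j j′ → j ≤ j′ → j′ ≤ depth u → anc j u ≡ up (j′ ∸ j) (anc j′ u)
  anc-up {u} j j′ j≤j′ j′≤d = begin
    up (depth u ∸ j) u                  ≡⟨ cong (λ i → up i u) shift ⟩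
    up ((j′ ∸ j) + (depth u ∸ j′)) u    ≡⟨ sym (up-+ (j′ ∸ j) (depth u ∸ j′) u) ⟩
    up (j′ ∸ j) (anc j′ u)              ∎
    where
    open ≡-Reasoning
    shift : depth u ∸ j ≡ (j′ ∸ j) + (depth u ∸ j′)
    shift = begin
      depth u ∸ j                       ≡⟨ cong (_∸ j) (sym (m∸n+n≡m j′≤d)) ⟩
      (depth u ∸ j′ + j′) ∸ j           ≡⟨ +-∸-assoc (depth u ∸ j′) j≤j′ ⟩
      (depth u ∸ j′) + (j′ ∸ j)         ≡⟨ +-comm (depth u ∸ j′) (j′ ∸ j) ⟩
      (j′ ∸ j) + (depth u ∸ j′)         ∎

  anc-agree-below : ∀ {u v} j j′ → j ≤ j′ → j′ ≤ depth u → j′ ≤ depth v →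
                    anc j′ u ≡ anc j′ v → anc j u ≡ anc j v
  anc-agree-below j j′ j≤j′ j′≤du j′≤dv e =
    trans (anc-up j j′ j≤j′ j′≤du) (trans (cong (up (j′ ∸ j)) e) (sym (anc-up j j′ j≤j′ j′≤dv)))

  anc-parent : ∀ {v} j → 0 < depth v → depth v ≤ K → j ≤ depth (parent v) → anc j v ≡ anc j (parent v)
  anc-parent {v} j 0<d d≤K j≤dp = begin
    up (depth v ∸ j) v
      ≡⟨ cong (λ d → up (d ∸ j) v) (sym (proj₂ (parent-spec 0<d d≤K))) ⟩
    up (suc (depth (parent v)) ∸ j) v
      ≡⟨ cong (λ i → up i v) (trans (+-∸-assoc 1 j≤dp) (+-comm 1 _)) ⟩
    up ((depth (parent v) ∸ j) + 1) v
      ≡⟨ sym (up-+ (depth (parent v) ∸ j) 1 v) ⟩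
    up (depth (parent v) ∸ j) (parent v) ∎
    where open ≡-Reasoning

  private
    module Common (u v : Fin n) = Greatest (λ j → anc j u ≟ anc j v)

  meet : Fin n → Fin n → ℕ
  meet u v = Common.greatest u v (depth u ⊓ depth v)

  meet-≤ˡ : ∀ u v → meet u v ≤ depth u
  meet-≤ˡ u v = ≤-trans (Common.greatest-≤ u v _) (m⊓n≤m (depth u) (depth v))

  meet-≤ʳ : ∀ u v → meet u v ≤ depth v
  meet-≤ʳ u v = ≤-trans (Common.greatest-≤ u v _) (m⊓n≤n (depth u) (depth v))

  meet-agree : ∀ {u v} → depth u ≤ K → depth v ≤ K → anc (meet u v) u ≡ anc (meet u v) v
  meet-agree {u} {v} du≤K dv≤K =
    Common.greatest-holds u v (trans (anc-root du≤K) (sym (anc-root dv≤K))) (depth u ⊓ depth v)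

  meet-max : ∀ {u v} j → j ≤ depth u → j ≤ depth v → anc j u ≡ anc j v → j ≤ meet u v
  meet-max {u} {v} j j≤du j≤dv = Common.greatest-max u v (depth u ⊓ depth v) j (⊓-glb j≤du j≤dv)

  meet-sym : ∀ {u v} → depth u ≤ K → depth v ≤ K → meet u v ≡ meet v u
  meet-sym {u} {v} du≤K dv≤K = ≤-antisym
    (meet-max _ (meet-≤ʳ u v) (meet-≤ˡ u v) (sym (meet-agree du≤K dv≤K)))
    (meet-max _ (meet-≤ʳ v u) (meet-≤ˡ v u) (sym (meet-agree dv≤K du≤K)))

  meet-ultra : ∀ {u v w} → depth u ≤ K → depth v ≤ K → depth w ≤ K →
               meet u w ⊓ meet v w ≤ meet u v
  meet-ultra {u} {v} {w} du≤K dv≤K dw≤K =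
    meet-max μ (≤-trans μ≤uw (meet-≤ˡ u w)) (≤-trans μ≤vw (meet-≤ˡ v w))
    (trans (agree-with-w u μ≤uw du≤K) (sym (agree-with-w v μ≤vw dv≤K)))
    where
    μ = meet u w ⊓ meet v w
    μ≤uw = m⊓n≤m (meet u w) (meet v w)
    μ≤vw = m⊓n≤n (meet u w) (meet v w)
    agree-with-w : ∀ x → μ ≤ meet x w → depth x ≤ K → anc μ x ≡ anc μ w
    agree-with-w x μ≤xw dx≤K =
      anc-agree-below μ (meet x w) μ≤xw (meet-≤ˡ x w) (meet-≤ʳ x w) (meet-agree dx≤K dw≤K)

  meet-isosceles : ∀ {u v w} → depth u ≤ K → depth v ≤ K → depth w ≤ K →
                   meet u w ≤ meet u v → meet v w ≤ meet u v → meet u w ≡ meet v w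
  meet-isosceles {u} {v} {w} du≤K dv≤K dw≤K uw≤uv vw≤uv = ≤-antisym
    (subst (_≤ meet v w) (trans (cong₂ _⊓_ (meet-sym dv≤K du≤K) (meet-sym dw≤K du≤K)) (m≥n⇒m⊓n≡n uw≤uv))
           (meet-ultra dv≤K dw≤K du≤K))
    (subst (_≤ meet u w) (trans (cong (meet u v ⊓_) (meet-sym dw≤K dv≤K)) (m≥n⇒m⊓n≡n vw≤uv))
           (meet-ultra du≤K dw≤K dv≤K))

  -- The length of the walk from u up to the common ancestor and down to v.
  tdist : Fin n → Fin n → ℕ
  tdist u v = (depth u ∸ meet u v) + (depth v ∸ meet u v)

  tdist-meet : ∀ u v → tdist u v + 2 * meet u v ≡ depth u + depth v
  tdist-meet u v = begin
    (du ∸ l) + (dv ∸ l) + 2 * l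
      ≡⟨ solve 3 (λ x y m → x :+ y :+ con 2 :* m := (x :+ m) :+ (y :+ m)) refl (du ∸ l) (dv ∸ l) l ⟩
    ((du ∸ l) + l) + ((dv ∸ l) + l)
      ≡⟨ cong₂ _+_ (m∸n+n≡m (meet-≤ˡ u v)) (m∸n+n≡m (meet-≤ʳ u v)) ⟩
    du + dv ∎
    where
    open ≡-Reasoning
    du = depth u
    dv = depth v
    l = meet u v

  tdist-within : ∀ {u v} → depth u ≤ K → depth v ≤ K → Within G (tdist u v) u v
  tdist-within {u} {v} du≤K dv≤K =
    within-++ (up-within (depth u ∸ meet u v) du≤K (m∸n≤m (depth u) (meet u v)))
              (subst (λ a → Within G (depth v ∸ meet u v) a v) (sym (meet-agree du≤K dv≤K))
                     (within-sym (up-within (depth v ∸ meet u v) dv≤K (m∸n≤m (depth v) (meet u v)))))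

  tdist-balance : ∀ {x y} w → depth x ≡ depth y →
                  tdist x w + 2 * meet x w ≡ tdist y w + 2 * meet y w
  tdist-balance {x} {y} w dx≡dy =
    trans (tdist-meet x w) (trans (cong (_+ depth w) dx≡dy) (sym (tdist-meet y w)))

  tdist-closer : ∀ {x y} w → depth x ≡ depth y → meet x w ≤ meet y w → tdist y w ≤ tdist x w
  tdist-closer {x} {y} w dx≡dy mx≤my =
    +-cancelʳ-≤ (2 * meet x w) (tdist y w) (tdist x w)
      (≤-trans (+-monoʳ-≤ (tdist y w) (*-monoʳ-≤ 2 mx≤my))
               (≤-reflexive (sym (tdist-balance w dx≡dy))))

module Tree {n : ℕ} (G : Graph n) (acyclic : Acyclic G) (z : Fin n) (K : ℕ) where
  open Walks G
  open Paths G
  open BreadthFirst G z K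

  private
    no-closed-path : ∀ {a b m} (π : Path G a b m) → 2 ≤ m → Adj G b a → ⊥
    no-closed-path {m = m} π 2≤m b~a = acyclic (applyUpTo (Path.vertex π) (suc m)) (closed-path-is-cycle π 2≤m b~a)

  LowPath : Fin n → Fin n → ℕ → ℕ → Set
  LowPath p q m k = Σ (Path G p q m) λ π → AllOn π (λ v → depth v ≤ k)

  low-avoids : ∀ {p q m k x} (π : LowPath p q m k) → k < depth x → Avoids (proj₁ π) x
  low-avoids (_ , low) k<dx r r≤m refl = <⇒≱ k<dx (low r r≤m)

  extend-fork : ∀ {k m p q p′ q′} → depth p ≡ suc k → depth q ≡ suc k → p ≢ q →
                Adj G p′ p → Adj G q′ q → LowPath p′ q′ m k → LowPath p q (suc (suc m)) (suc k)
  extend-fork {k} {p = p} {q} dp dq p≢q p′~p q′~q (π , low) =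
      snoc π₁ q q′~q q-fresh
    , snoc-all π₁ q q′~q q-fresh (cons-all p π p~p′ p-fresh (≤-reflexive dp) low′) (≤-reflexive dq)
    where
    p~p′ = adj-sym p′~p
    p-fresh = low-avoids (π , low) (≤-reflexive (sym dp))
    π₁ = cons p π p~p′ p-fresh
    q-fresh : Avoids π₁ q
    q-fresh = cons-all p π p~p′ p-fresh p≢q (low-avoids (π , low) (≤-reflexive (sym dq)))
    low′ : AllOn π (λ v → depth v ≤ suc k)
    low′ r r≤m = m≤n⇒m≤1+n (low r r≤m)

  -- Distinct vertices at depth k are joined by a path of length ≥ 2 through
  -- vertices of depth ≤ k: go up from both until the ancestries merge.
  fork-path : ∀ k {p q} → depth p ≡ k → depth q ≡ k → k ≤ K → p ≢ q →
              ∃ λ m → LowPath p q (suc (suc m)) k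
  fork-path zero dp≡0 dq≡0 _ p≢q = ⊥-elim (p≢q (trans (sym (depth-zero dp≡0)) (depth-zero dq≡0)))
  fork-path (suc k) {p} {q} dp dq 1+k≤K p≢q =
    let (m , π) = parents-joined in m , extend-fork dp dq p≢q (proj₁ (parent-of dp)) (proj₁ (parent-of dq)) π
    where
    parent-of : ∀ {u} → depth u ≡ suc k → IsParent (parent u) u
    parent-of du = parent-spec (subst (0 <_) (sym du) z<s) (subst (_≤ K) (sym du) 1+k≤K)
    parent-depth : ∀ {u} → depth u ≡ suc k → depth (parent u) ≡ k
    parent-depth du = suc-injective (trans (proj₂ (parent-of du)) du)
    parents-joined : ∃ λ m → LowPath (parent p) (parent q) m k
    parents-joined with parent p ≟ parent q
    ... | yes same = 0 , subst (λ q′ → LowPath (parent p) q′ 0 k) same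
                               (stay (parent p) , λ _ _ → ≤-reflexive (parent-depth dp))
    ... | no distinct = let (m , π) = fork-path k (parent-depth dp) (parent-depth dq) (<⇒≤ 1+k≤K) distinct
                        in suc (suc m) , π

  no-level-edge : ∀ {p q} → Adj G p q → depth p ≡ depth q → depth p ≤ K → ⊥
  no-level-edge {p} {q} p~q dp≡dq dp≤K with p ≟ q
  ... | yes refl = subst T (Graph.irrefl G p) p~q
  ... | no p≢q = let (m , π , _) = fork-path (depth p) refl (sym dp≡dq) dp≤K p≢q
                 in no-closed-path π (s≤s (s≤s z≤n)) (adj-sym p~q)

  parent-unique : ∀ {w u} → IsParent w u → depth u ≤ K → w ≡ parent u
  parent-unique {w} {u} (w~u , 1+dw≡du) du≤K with w ≟ parent u
  ... | yes w≡p = w≡p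
  ... | no w≢p =
    ⊥-elim (no-closed-path (cons u π (adj-sym w~u) (low-avoids (π , low) dw<du)) (s≤s (s≤s z≤n)) p~u)
    where
    p-spec = parent-spec (subst (0 <_) 1+dw≡du z<s) du≤K
    p~u = proj₁ p-spec
    dw<du : depth w < depth u
    dw<du = ≤-reflexive 1+dw≡du
    dp≡dw : depth (parent u) ≡ depth w
    dp≡dw = suc-injective (trans (proj₂ p-spec) (sym 1+dw≡du))
    low-fork = proj₂ (fork-path (depth w) refl dp≡dw (<⇒≤ (<-≤-trans dw<du du≤K)) w≢p)
    π = proj₁ low-fork
    low = proj₂ low-fork

  edge-parent : ∀ {w v} → Adj G w v → depth w ≤ K → depth v ≤ K → IsParent w v ⊎ IsParent v w
  edge-parent {w} {v} w~v dw≤K dv≤K with <-cmp (depth w) (depth v)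
  ... | tri< dw<dv _ _ = inj₁ (w~v , ≤-antisym dw<dv (depth-edge w~v))
  ... | tri≈ _ dw≡dv _ = ⊥-elim (no-level-edge w~v dw≡dv dw≤K)
  ... | tri> _ _ dv<dw = inj₂ (adj-sym w~v , ≤-antisym dv<dw (depth-edge (adj-sym w~v)))

  meet-parent : ∀ {p c} → IsParent p c → depth c ≤ K → depth p ≤ meet c p
  meet-parent {p} {c} p-par dc≤K with parent-unique p-par dc≤K
  ... | refl = meet-max (depth p) (<⇒≤ (≤-reflexive (proj₂ p-par))) ≤-refl
                 (anc-parent (depth p) (subst (0 <_) (proj₂ p-par) z<s) dc≤K ≤-refl)

  meet-edge : ∀ {w v} → Adj G w v → depth w ≤ K → depth v ≤ K → depth v ⊓ depth w ≤ meet v w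
  meet-edge {w} {v} w~v dw≤K dv≤K with edge-parent w~v dw≤K dv≤K
  ... | inj₁ w-par = ≤-trans (m⊓n≤n (depth v) (depth w)) (meet-parent w-par dv≤K)
  ... | inj₂ v-par = ≤-trans (m⊓n≤m (depth v) (depth w))
                             (subst (depth v ≤_) (meet-sym dw≤K dv≤K) (meet-parent v-par dw≤K))

  private
    -- The arithmetic of one step in `walk-lower`: a is the depth of the
    -- start, c and b the depths of the last two vertices, l the old meet and
    -- μ the new one.
    walk-step-arith : ∀ {a b c m l μ} → a + c ≤ m + 2 * l → l ≤ c → b ≡ suc c ⊎ c ≡ suc b →
                      l ⊓ (b ⊓ c) ≤ μ → a + b ≤ suc m + 2 * μ
    walk-step-arith {a} {b} {c} {m} {l} {μ} ih l≤c (inj₁ refl) bound = begin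
      a + suc c        ≡⟨ +-suc a c ⟩
      suc (a + c)      ≤⟨ s≤s ih ⟩
      suc m + 2 * l    ≤⟨ +-monoʳ-≤ (suc m) (*-monoʳ-≤ 2 l≤μ) ⟩
      suc m + 2 * μ    ∎
      where
      open ≤-Reasoning
      l≤μ : l ≤ μ
      l≤μ = subst (_≤ μ) (trans (cong (l ⊓_) (m≥n⇒m⊓n≡n (n≤1+n c))) (m≤n⇒m⊓n≡m l≤c)) bound
    walk-step-arith {a} {b} {c} {m} {l} {μ} ih l≤c (inj₂ refl) bound with l ≤? b
    ... | yes l≤b = begin
      a + b            ≤⟨ +-monoʳ-≤ a (n≤1+n b) ⟩
      a + suc b        ≤⟨ ih ⟩
      m + 2 * l        ≤⟨ +-mono-≤ (n≤1+n m) (*-monoʳ-≤ 2 l≤μ) ⟩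
      suc m + 2 * μ    ∎
      where
      open ≤-Reasoning
      l≤μ : l ≤ μ
      l≤μ = subst (_≤ μ) (trans (cong (l ⊓_) (m≤n⇒m⊓n≡m (n≤1+n b))) (m≤n⇒m⊓n≡m l≤b)) bound
    ... | no l≰b = begin
      a + b                  ≤⟨ +-monoˡ-≤ b a≤m+c ⟩
      m + suc b + b          ≡⟨ solve 2 (λ m b → m :+ (con 1 :+ b) :+ b := con 1 :+ m :+ con 2 :* b) refl m b ⟩
      suc m + 2 * b          ≤⟨ +-monoʳ-≤ (suc m) (*-monoʳ-≤ 2 b≤μ) ⟩
      suc m + 2 * μ          ∎
      where
      open ≤-Reasoning
      l≡c : l ≡ suc b
      l≡c = ≤-antisym l≤c (≰⇒> l≰b)
      double : m + 2 * suc b ≡ m + suc b + suc b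
      double = solve 2 (λ m c → m :+ con 2 :* c := m :+ c :+ c) refl m (suc b)
      a≤m+c : a ≤ m + suc b
      a≤m+c = +-cancelʳ-≤ (suc b) a (m + suc b)
                (subst (a + suc b ≤_) (trans (cong (λ x → m + 2 * x) l≡c) double) ih)
      b≤μ : b ≤ μ
      b≤μ = subst (_≤ μ) (trans (cong (l ⊓_) (m≤n⇒m⊓n≡m (n≤1+n b))) (m≥n⇒m⊓n≡n (<⇒≤ (≰⇒> l≰b))))
                  bound

  walk-lower : ∀ m {u v} → Within G m u v → depth u + m ≤ K → depth u + depth v ≤ m + 2 * meet u v
  walk-lower zero {u} r _ with within-zero r
  ... | refl = +-mono-≤ du≤meet (subst (depth u ≤_) (sym (+-identityʳ (meet u u))) du≤meet)
    where du≤meet = meet-max (depth u) ≤-refl ≤-refl refl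
  walk-lower (suc m) {u} {v} r du+1+m≤K with within-inv r
  ... | inj₁ short = ≤-trans (walk-lower m short du+m≤K) (+-monoˡ-≤ _ (n≤1+n m))
    where du+m≤K = ≤-trans (+-monoʳ-≤ (depth u) (n≤1+n m)) du+1+m≤K
  ... | inj₂ (w , r′ , w~v) =
    walk-step-arith {m = m} {μ = meet u v} (walk-lower m r′ du+m≤K) (meet-≤ʳ u w) depth-step
      (≤-trans (⊓-monoʳ-≤ (meet u w) (meet-edge w~v dw≤K dv≤K)) (meet-ultra du≤K dv≤K dw≤K))
    where
    du+m≤K = ≤-trans (+-monoʳ-≤ (depth u) (n≤1+n m)) du+1+m≤K
    du≤K = ≤-trans (m≤m+n (depth u) m) du+m≤K
    dw≤K = ≤-trans (depth-walk du+m≤K r′) du+m≤K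
    dv≤K = ≤-trans (depth-walk du+1+m≤K r) du+1+m≤K
    depth-step : depth v ≡ suc (depth w) ⊎ depth w ≡ suc (depth v)
    depth-step with edge-parent w~v dw≤K dv≤K
    ... | inj₁ (_ , e) = inj₁ (sym e)
    ... | inj₂ (_ , e) = inj₂ (sym e)

  dist-tdist : ∀ {d u v} → IsDist G d u v → depth u + d ≤ K → d ≡ tdist u v
  dist-tdist {d} {u} {v} (r , short) du+d≤K = ≤-antisym d≤t t≤d
    where
    du≤K = ≤-trans (m≤m+n (depth u) d) du+d≤K
    dv≤K = ≤-trans (depth-walk du+d≤K r) du+d≤K
    d≤t : d ≤ tdist u v
    d≤t with tdist u v <? d
    ... | yes t<d = ⊥-elim (short _ t<d (tdist-within du≤K dv≤K))
    ... | no t≮d = ≮⇒≥ t≮d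
    t≤d : tdist u v ≤ d
    t≤d = +-cancelʳ-≤ (2 * meet u v) (tdist u v) d
            (subst (_≤ d + 2 * meet u v) (sym (tdist-meet u v)) (walk-lower d r du+d≤K))

injection-bound : ∀ {A : Set} {n} (φ : Fin n → A) (L : List A) → (∀ x → φ x ∈ L) →
                  (∀ {x y} → φ x ≡ φ y → x ≡ y) → n ≤ length L
injection-bound φ L listed injective = injective⇒≤ {f = λ x → index (listed x)} λ {x} {y} e →
  injective (trans (lookup-index (listed x)) (trans (cong (lookup L) e) (sym (lookup-index (listed y)))))

length-cartesianProduct : ∀ {A B : Set} (xs : List A) (ys : List B) →
                          length (cartesianProduct xs ys) ≡ length xs * length ys
length-cartesianProduct [] ys = refl
length-cartesianProduct (x ∷ xs) ys =
  trans (length-++ (map (x ,_) ys)) (cong₂ _+_ (length-map (x ,_) ys) (length-cartesianProduct xs ys))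

readingsAt : ∀ {n} → Fin n → ℕ → List (Fin n × ℕ)
readingsAt w zero = []
readingsAt w (suc k) = map (w ,_) (upTo (suc (suc k)))

readingsAt-length : ∀ {n} (w : Fin n) k → length (readingsAt w k) ≤ 2 * k
readingsAt-length w zero = z≤n
readingsAt-length w (suc k) = begin
  length (map (w ,_) (upTo (suc (suc k))))
    ≡⟨ trans (length-map (w ,_) (upTo (suc (suc k)))) (length-upTo (suc (suc k))) ⟩
  suc (suc k)
    ≤⟨ s≤s (subst (λ t → suc k ≤ k + t) (sym (*-identityˡ (suc k))) (m≤n+m (suc k) k)) ⟩
  2 * suc k ∎
  where open ≤-Reasoning

readingsAt-complete : ∀ {n} {w : Fin n} {k a} → 1 ≤ k → a ≤ k → (w , a) ∈ readingsAt w k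
readingsAt-complete {k = suc k} _ a≤k = ∈-map⁺ _ (∈-upTo⁺ (s≤s a≤k))

possibleReadings : ∀ {n} → (Fin n → ℕ) → List (Fin n × ℕ)
possibleReadings {zero} f = []
possibleReadings {suc n} f =
  readingsAt Fin.zero (f Fin.zero) ++ map (map₁ Fin.suc) (possibleReadings (λ i → f (Fin.suc i)))

possibleReadings-length : ∀ {n} (f : Fin n → ℕ) → length (possibleReadings f) ≤ 2 * cost f
possibleReadings-length {zero} f = z≤n
possibleReadings-length {suc n} f = begin
  length (readingsAt Fin.zero (f Fin.zero) ++ map (map₁ Fin.suc) (possibleReadings f′))
    ≡⟨ length-++ (readingsAt Fin.zero (f Fin.zero)) ⟩
  length (readingsAt Fin.zero (f Fin.zero)) + length (map (map₁ Fin.suc) (possibleReadings f′))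
    ≡⟨ cong (length (readingsAt Fin.zero (f Fin.zero)) +_) (length-map (map₁ Fin.suc) (possibleReadings f′)) ⟩
  length (readingsAt Fin.zero (f Fin.zero)) + length (possibleReadings f′)
    ≤⟨ +-mono-≤ (readingsAt-length Fin.zero (f Fin.zero)) (possibleReadings-length f′) ⟩
  2 * f Fin.zero + 2 * cost f′
    ≡⟨ sym (*-distribˡ-+ 2 (f Fin.zero) (cost f′)) ⟩
  2 * cost f ∎
  where
  open ≤-Reasoning
  f′ = λ i → f (Fin.suc i)

possibleReadings-complete : ∀ {n} (f : Fin n → ℕ) {w a} → 1 ≤ f w → a ≤ f w → (w , a) ∈ possibleReadings f
possibleReadings-complete {suc n} f {Fin.zero} 1≤f a≤f = ∈-++⁺ˡ (readingsAt-complete 1≤f a≤f)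
possibleReadings-complete {suc n} f {Fin.suc w} 1≤f a≤f =
  ∈-++⁺ʳ _ (∈-map⁺ (map₁ Fin.suc) (possibleReadings-complete (λ i → f (Fin.suc i)) 1≤f a≤f))

value-≤-cost : ∀ {n} (f : Fin n → ℕ) w → f w ≤ cost f
value-≤-cost f Fin.zero = m≤m+n (f Fin.zero) _
value-≤-cost f (Fin.suc w) = ≤-trans (value-≤-cost (λ i → f (Fin.suc i)) w) (m≤n+m _ (f Fin.zero))

module Broadcast {n : ℕ} (G : Graph n) (acyclic : Acyclic G) (f : Fin n → ℕ) where
  open Walks G

  s K : ℕ
  s = cost f
  K = s + s

  reading : Fin n → Fin n → ℕ
  reading x w = dk G (f w) x w

  Hears : Fin n → Fin n → Set
  Hears w x = 1 ≤ f w × reading x w ≤ f w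

  hears? : ∀ w x → Dec (Hears w x)
  hears? w x = (1 ≤? f w) ×-dec (reading x w ≤? f w)

  private
    module Reading (x w : Fin n) = TruncatedDistance G (f w) x w

  heard-dist : ∀ {w x} → Hears w x → IsDist G (reading x w) x w
  heard-dist {w} {x} (_ , d≤f) = Reading.dk-within x w d≤f , Reading.dk-minimal x w

  heard-≤ : ∀ {w x} → Hears w x → reading x w ≤ s
  heard-≤ {w} (_ , d≤f) = ≤-trans d≤f (value-≤-cost f w)

  unheard : ∀ {w x} → 1 ≤ f w → ¬ Hears w x → reading x w ≡ suc (f w)
  unheard {w} {x} 1≤f ¬heard = Reading.dk-far x w (λ d≤f → ¬heard (1≤f , d≤f))

  unheard-both : ∀ {w x y} → ¬ f w ≡ 0 → ¬ Hears w x → ¬ Hears w y → reading x w ≡ reading y w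
  unheard-both f≢0 ¬hx ¬hy = trans (unheard 1≤f ¬hx) (sym (unheard 1≤f ¬hy))
    where 1≤f = n≢0⇒n>0 f≢0

  -- Fix a broadcaster z and its breadth-first tree truncated at depth K = 2s:
  -- it contains every vertex heard by z and all hearers of such vertices.
  module Rooted (z : Fin n) where
    open BreadthFirst G z K
    open Tree G acyclic z K

    depth-heard : ∀ {x} → Hears z x → depth x ≡ reading x z
    depth-heard h = TruncatedDistance.dk-exact G K z _ _ (isDist-sym (heard-dist h)) (≤-trans (heard-≤ h) (m≤m+n s s))

    depth-heard-≤ : ∀ {x} → Hears z x → depth x ≤ s
    depth-heard-≤ h = subst (_≤ s) (sym (depth-heard h)) (heard-≤ h)

    reach-≤-K : ∀ {w x} → Hears z x → Hears w x → depth x + reading x w ≤ K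
    reach-≤-K hz hw = +-mono-≤ (depth-heard-≤ hz) (heard-≤ hw)

    depth-heard-≤-K : ∀ {x} → Hears z x → depth x ≤ K
    depth-heard-≤-K h = ≤-trans (depth-heard-≤ h) (m≤m+n s s)

    depth-hearer-≤-K : ∀ {w x} → Hears z x → Hears w x → depth w ≤ K
    depth-hearer-≤-K hz hw = ≤-trans (depth-walk (reach-≤-K hz hw) (proj₁ (heard-dist hw))) (reach-≤-K hz hw)

    reading-tdist : ∀ {w x} → Hears z x → Hears w x → reading x w ≡ tdist x w
    reading-tdist hz hw = dist-tdist (heard-dist hw) (reach-≤-K hz hw)

    hears-closer : ∀ {w x y} → Hears z x → Hears z y → depth x ≡ depth y → Hears w x →
                   meet x w ≤ meet y w → Hears w y
    hears-closer {w} {x} {y} hzx hzy dx≡dy hwx mx≤my =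
      proj₁ hwx , ≤-trans reading≤tdist (≤-trans t≤t (proj₂ hwx))
      where
      t≤t : tdist y w ≤ reading x w
      t≤t = subst (tdist y w ≤_) (sym (reading-tdist hzx hwx)) (tdist-closer w dx≡dy mx≤my)
      reading≤tdist : reading y w ≤ tdist y w
      reading≤tdist = TruncatedDistance.dk-≤ G (f w) y w (tdist y w)
        (tdist-within (depth-heard-≤-K hzy) (depth-hearer-≤-K hzx hwx)) (≤-trans t≤t (proj₂ hwx))

    same-meet-same-reading : ∀ {w x y} → Hears z x → Hears z y → depth x ≡ depth y → Hears w x →
                             meet x w ≡ meet y w → reading x w ≡ reading y w
    same-meet-same-reading {w} hzx hzy dx≡dy hwx mx≡my = begin
      reading _ w
        ≡⟨ reading-tdist hzx hwx ⟩
      tdist _ w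
        ≡⟨ +-cancelʳ-≡ _ _ _ (trans (tdist-balance w dx≡dy) (cong (λ l → tdist _ w + 2 * l) (sym mx≡my))) ⟩
      tdist _ w
        ≡⟨ sym (reading-tdist hzy (hears-closer hzx hzy dx≡dy hwx (≤-reflexive mx≡my))) ⟩
      reading _ w ∎
      where open ≡-Reasoning

    separator-is-deep : ∀ {w x y} → Hears z x → Hears z y → depth x ≡ depth y → Hears w x →
                        reading x w ≢ reading y w →
                        meet x y < meet x w ⊎ (Hears w y × meet x y < meet y w)
    separator-is-deep {w} {x} {y} hzx hzy dx≡dy hwx differ with meet x y <? meet x w
    ... | yes deeper = inj₁ deeper
    ... | no ¬deeper with meet x y <? meet y w
    ...   | yes deeper = inj₂ (hears-closer hzx hzy dx≡dy hwx (≤-trans (≮⇒≥ ¬deeper) (<⇒≤ deeper)) , deeper)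
    ...   | no ¬deeper′ = ⊥-elim (differ (same-meet-same-reading hzx hzy dx≡dy hwx
              (meet-isosceles (depth-heard-≤-K hzx) (depth-heard-≤-K hzy) (depth-hearer-≤-K hzx hwx)
                              (≮⇒≥ ¬deeper) (≮⇒≥ ¬deeper′))))

    no-collision : ∀ {w x y} → x ≢ y → Hears z x → Hears z y → reading x z ≡ reading y z →
                   Hears w x → Hears w y → reading x w ≡ reading y w →
                   (∀ w′ → Hears w′ x → meet x w′ ≤ meet x w) →
                   (∀ w′ → Hears w′ y → meet y w′ ≤ meet y w) →
                   IsResolvingBroadcast G f → ⊥
    no-collision {w} {x} {y} x≢y hzx hzy same-z hwx hwy same-w best-x best-y resolving =
      no-separator (resolving x y x≢y)
      where
      dx≡dy = trans (depth-heard hzx) (trans same-z (sym (depth-heard hzy)))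
      dx≤K = depth-heard-≤-K hzx
      dy≤K = depth-heard-≤-K hzy
      dw≤K = depth-hearer-≤-K hzx hwx
      -- The readings of w determine its meets with x and y, which coincide …
      mx≡my : meet x w ≡ meet y w
      mx≡my = *-cancelˡ-≡ _ _ 2 (+-cancelˡ-≡ (tdist x w) _ _ (trans (tdist-balance w dx≡dy)
                (cong (_+ 2 * meet y w) (trans (sym (reading-tdist hzy hwy)) (trans (sym same-w) (reading-tdist hzx hwx))))))
      -- … and are therefore bounded by the meet of x and y.
      mw≤mxy : meet x w ≤ meet x y
      mw≤mxy = subst (_≤ meet x y) (trans (cong (meet x w ⊓_) (sym mx≡my)) (⊓-idem (meet x w)))
                     (meet-ultra dx≤K dy≤K dw≤K)
      too-deep-x : ∀ {w′} → meet x y < meet x w′ → meet x w′ ≤ meet x w → ⊥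
      too-deep-x deeper bounded = <-irrefl refl (<-≤-trans deeper (≤-trans bounded mw≤mxy))
      too-deep-y : ∀ {w′} → meet x y < meet y w′ → meet y w′ ≤ meet y w → ⊥
      too-deep-y deeper bounded =
        <-irrefl refl (<-≤-trans deeper (≤-trans bounded (subst (_≤ meet x y) mx≡my mw≤mxy)))
      no-separator : (∃ λ w′ → ¬ f w′ ≡ 0 × reading x w′ ≢ reading y w′) → ⊥
      no-separator (w′ , f≢0 , differ) with hears? w′ x | hears? w′ y
      ... | yes hx | _ =
        [ (λ deeper → too-deep-x deeper (best-x w′ hx))
        , (λ (hy , deeper) → too-deep-y deeper (best-y w′ hy)) ] (separator-is-deep hzx hzy dx≡dy hx differ)
      ... | no _ | yes hy =
        [ (λ deeper → too-deep-y (subst (_< meet y w′) (meet-sym dy≤K dx≤K) deeper) (best-y w′ hy))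
        , (λ (hx , deeper) → too-deep-x (subst (_< meet x w′) (meet-sym dy≤K dx≤K) deeper) (best-x w′ hx)) ]
          (separator-is-deep hzy hzx (sym dx≡dy) hy (differ ∘ sym))
      ... | no ¬hx | no ¬hy = differ (unheard-both f≢0 ¬hx ¬hy)

  -- The hearers of x, and among them the one sharing the most ancestry with x
  -- in the tree rooted at z (z itself if no hearer beats it).
  hearers : Fin n → List (Fin n)
  hearers x = filter (λ w → hears? w x) (allFin n)

  best : Fin n → Fin n → Fin n
  best z x = argmax (BreadthFirst.meet G z K x) z (hearers x)

  best-hears : ∀ {z x} → Hears z x → Hears (best z x) x
  best-hears {z} {x} hz = argmax-all (BreadthFirst.meet G z K x) hz (all-filter (λ w → hears? w x) (allFin n))

  best-is-best : ∀ z {x w} → Hears w x → BreadthFirst.meet G z K x w ≤ BreadthFirst.meet G z K x (best z x)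
  best-is-best z {x} {w} hw =
    All.lookup (f[xs]≤f[argmax] {f = BreadthFirst.meet G z K x} z (hearers x))
               (∈-filter⁺ (λ w → hears? w x) (∈-allFin w) hw)

  Code : Set
  Code = Maybe ((Fin n × ℕ) × (Fin n × ℕ))

  encode : ∀ x → Dec (∃ λ z → Hears z x) → Code
  encode x (no _) = nothing
  encode x (yes (z , _)) = just ((z , reading x z) , (best z x , reading x (best z x)))

  code : Fin n → Code
  code x = encode x (any? (λ z → hears? z x))

  code-injective : IsResolvingBroadcast G f → ∀ {x y} → code x ≡ code y → x ≡ y
  code-injective resolving {x} {y} = encode-injective (any? (λ z → hears? z x)) (any? (λ z → hears? z y))
    where
    encode-injective : ∀ dx dy → encode x dx ≡ encode y dy → x ≡ y
    encode-injective _ _ _ with x ≟ y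
    ... | yes x≡y = x≡y
    encode-injective (no ¬hx) (no ¬hy) _ | no x≢y with resolving x y x≢y
    ... | w , f≢0 , differ = ⊥-elim (differ (unheard-both f≢0 (λ hx → ¬hx (w , hx)) (λ hy → ¬hy (w , hy))))
    encode-injective (yes (z , hzx)) (yes (z′ , hzy)) e | no x≢y
      with cong (λ c → proj₁ (proj₁ c)) (just-injective e)
    ... | refl = ⊥-elim (Rooted.no-collision z x≢y hzx hzy same-z (best-hears hzx) hwy same-w
                                           (λ _ → best-is-best z) best-for-y resolving)
      where
      open BreadthFirst G z K using (meet)
      e′ = just-injective e
      same-z = cong (λ c → proj₂ (proj₁ c)) e′
      same-best = cong (λ c → proj₁ (proj₂ c)) e′
      hwy : Hears (best z x) y
      hwy = subst (λ b → Hears b y) (sym same-best) (best-hears hzy)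
      same-w : reading x (best z x) ≡ reading y (best z x)
      same-w = trans (cong (λ c → proj₂ (proj₂ c)) e′) (cong (reading y) (sym same-best))
      best-for-y : ∀ w′ → Hears w′ y → meet y w′ ≤ meet y (best z x)
      best-for-y _ h = subst (λ b → meet y _ ≤ meet y b) (sym same-best) (best-is-best z h)

  codes : List Code
  codes = nothing ∷ map just (cartesianProduct (possibleReadings f) (possibleReadings f))

  code-listed : ∀ x → code x ∈ codes
  code-listed x with any? (λ z → hears? z x)
  ... | no _ = here refl
  ... | yes (z , hz) = there (∈-map⁺ just (∈-cartesianProduct⁺ (listed hz) (listed (best-hears hz))))
    where
    listed : ∀ {w} → Hears w x → (w , reading x w) ∈ possibleReadings f
    listed (1≤f , d≤f) = possibleReadings-complete f 1≤f d≤f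

  order-bound : IsResolvingBroadcast G f → n ≤ suc (2 * s * (2 * s))
  order-bound resolving = begin
    n                                   ≤⟨ injection-bound code codes code-listed (code-injective resolving) ⟩
    suc (length (map just R×R))         ≡⟨ cong suc (trans (length-map just R×R) (length-cartesianProduct R R)) ⟩
    suc (length R * length R)           ≤⟨ s≤s (*-mono-≤ (possibleReadings-length f) (possibleReadings-length f)) ⟩
    suc (2 * s * (2 * s))               ∎
    where
    open ≤-Reasoning
    R = possibleReadings f
    R×R = cartesianProduct R R

-- In any graph, all vertices but one form an adjacency resolving set: of two
-- distinct vertices, one lies in the set and is at distance 0 from itself only.
all-but-one : ∀ {n} (G : Graph n) → ∃ λ (A : Subset n) → IsAdjResolvingSet G A × ∣ A ∣ ≡ n ∸ 1
all-but-one {zero} G = Subset.⊥ , (λ ()) , refl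
all-but-one {suc n} G = outside Vec.∷ Subset.⊤ , separate , ∣⊤∣≡n n
  where
  open Walks G
  d₁-self : ∀ x → dk G 1 x x ≡ 0
  d₁-self x = TruncatedDistance.dk-exact G 1 x x 0 (within-refl x , λ _ ()) z≤n
  d₁-other : ∀ {x y} → x ≢ y → dk G 1 y x ≢ 0
  d₁-other {x} {y} x≢y d≡0 = x≢y (sym (within-zero (subst (λ j → Within G j y x) d≡0 walk)))
    where walk = TruncatedDistance.dk-within G 1 y x (subst (_≤ 1) (sym d≡0) z≤n)
  separate : IsAdjResolvingSet G (outside Vec.∷ Subset.⊤)
  separate Fin.zero Fin.zero x≢y = ⊥-elim (x≢y refl)
  separate Fin.zero (Fin.suc y) x≢y =
    Fin.suc y , Vec.there ∈⊤ , λ e → d₁-other (x≢y ∘ sym) (trans e (d₁-self (Fin.suc y)))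
  separate (Fin.suc x) y x≢y =
    Fin.suc x , Vec.there ∈⊤ , λ e → d₁-other x≢y (trans (sym e) (d₁-self (Fin.suc x)))

corollary4p6 : ∃ λ (C : ℕ) → ∀ (n : ℕ) (G : Graph n) → Acyclic G →
    ∀ (f : Fin n → ℕ) → IsResolvingBroadcast G f →
    ∃ λ (A : Subset n) → IsAdjResolvingSet G A × ∣ A ∣ ≤ C * (cost f * cost f)
corollary4p6 = 4 , λ n G acyclic f resolving →
  let (A , resolves , ∣A∣≡n∸1) = all-but-one G
      s = cost f
  in A , resolves , (begin
     ∣ A ∣                ≡⟨ ∣A∣≡n∸1 ⟩
     n ∸ 1                ≤⟨ ∸-monoˡ-≤ 1 (Broadcast.order-bound G acyclic f resolving) ⟩
     2 * s * (2 * s)      ≡⟨ solve 1 (λ s → con 2 :* s :* (con 2 :* s) := con 4 :* (s :* s)) refl s ⟩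
     4 * (s * s)          ∎)
  where open ≤-Reasoning
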